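{- Let $a>1$ be an integer, $p$ a prime, and $M_p^{(a)}=\frac{a^p-1}{a-1}$. If $\gcd(M_p^{(a)},a-1)=1$, then for any two divisors $d_1<d_2$ of $M_p^{(a)}$ (including $1$ and $M_p^{(a)}$), $p$ divides $d_2-d_1$. In particular, this holds for the Mersenne numbers $M_p=2^p-1$. -}

module Defs where

open import Data.Nat using (ℕ; suc; _∸_; _^_)
open import Data.Nat.DivMod using (_/_)

-- Generalised Mersenne number  M_p^{(a)} = (a^p - 1) / (a - 1).
-- The divisor is written  suc (a ∸ 2)  so that it is syntactically nonzero;
-- for a > 1 (the only case used) this equals a - 1.
M : ℕ → ℕ → ℕ
M a p = (a ^ p ∸ 1) / suc (a ∸ 2)

{-# OPTIONS --safe #-}
module Submission where

-- Every prime factor q of M = (aᵖ - 1)/(a - 1) satisfies aᵖ ≡ 1 (mod q), while a ≢ 1 (mod q)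
-- because q ∤ a - 1. So the multiplicative order of a modulo q is p, and by Fermat's little
-- theorem p ∣ q - 1. Hence every prime factor of M, and therefore every divisor of M (a product
-- of prime factors), is ≡ 1 (mod p), and any two divisors are congruent modulo p.

open import Defs
open import Data.Nat using (ℕ; _<_; _∸_; _^_)
open import Data.Nat.Divisibility using (_∣_)
open import Data.Nat.GCD using (gcd)
open import Data.Nat.Primality using (Prime)
open import Relation.Binary.PropositionalEquality using (_≡_)

open import Data.Nat.Base
  using (zero; suc; _+_; _*_; z<s; s<s; s≤s; ≢-nonZero; >-nonZero⁻¹; +-*-rawSemiring)
open import Data.Nat.Properties
open import Data.Nat.Combinatorics using (_C_; nC1≡n; nCn≡1; k>n⇒nCk≡0; nCk+nC[k+1]≡[n+1]C[k+1])
open import Data.Nat.Divisibility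
  using ( divides; _∣?_; _∣0; ∣-trans; ∣⇒≤; 0∣⇒≡0; ∣1⇒≡1
        ; ∣m∣n⇒∣m+n; ∣m+n∣m⇒∣n; m∣m*n; n∣m*n; ∣m⇒∣m*n)
open import Data.Nat.DivMod using (_/_; m*n/n≡m)
open import Data.Nat.GCD using (gcd-greatest; module Bézout)
open import Data.Nat.Coprimality using (Coprime; coprime-Bézout)
open import Data.Nat.Primality using (euclidsLemma; prime⇒irreducible; prime⇒nonZero; ¬prime[1])
open import Data.Nat.Primality.Factorisation using (factorise; module PrimeFactorisation)
open import Data.Nat.ListAction using (product)
open import Data.Nat.Tactic.RingSolver using (solve-∀)
open import Data.Fin.Base using (Fin; zero; suc; toℕ; fromℕ; inject₁)
open import Data.Fin.Properties using (toℕ<n; toℕ-fromℕ; toℕ-inject₁)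
open import Data.Vec.Functional using (Vector; head; tail; init; last)
open import Data.List.Base using ([]; _∷_)
open import Data.List.Relation.Unary.All using (All; []; _∷_)
open import Data.Product.Base using (∃-syntax; _,_)
open import Data.Sum.Base using (inj₁; inj₂)
open import Relation.Nullary using (¬_; yes; no; contradiction)
open import Relation.Binary.PropositionalEquality
  using (_≢_; refl; sym; trans; cong; cong₂; subst; module ≡-Reasoning)
open import Algebra.Definitions.RawSemiring +-*-rawSemiring
  using (sum) renaming (_^_ to _^ᴬ_; _×_ to _×ᴬ_)
open import Algebra.Properties.Monoid.Sum +-0-monoid using (sum-init-last)
open import Algebra.Properties.CommutativeSemigroup *-commutativeSemigroup using (xy∙z≈xz∙y)
import Algebra.Properties.CommutativeSemiring.Binomial +-*-commutativeSemiring as Binomial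

open Bézout using (+-; -+)

[k+1]*[n+1]C[k+1]≡[n+1]*nCk : ∀ n k → suc k * (suc n C suc k) ≡ suc n * (n C k)
[k+1]*[n+1]C[k+1]≡[n+1]*nCk n zero =
  trans (*-identityˡ (suc n C 1)) (trans (nC1≡n (suc n)) (sym (*-identityʳ (suc n))))
[k+1]*[n+1]C[k+1]≡[n+1]*nCk zero (suc k) = begin
  suc (suc k) * (1 C suc (suc k)) ≡⟨ cong (suc (suc k) *_) (k>n⇒nCk≡0 {1} {suc (suc k)} (s<s z<s)) ⟩
  suc (suc k) * 0                 ≡⟨ *-zeroʳ (suc (suc k)) ⟩
  0                               ≡⟨ cong (1 *_) (k>n⇒nCk≡0 {0} {suc k} z<s) ⟨
  1 * (0 C suc k)                 ∎
  where open ≡-Reasoning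
[k+1]*[n+1]C[k+1]≡[n+1]*nCk (suc n) (suc k) = begin
  suc (suc k) * (suc (suc n) C suc (suc k))
    ≡⟨ cong (suc (suc k) *_) (nCk+nC[k+1]≡[n+1]C[k+1] (suc n) (suc k)) ⟨
  suc (suc k) * (c₁ + c₂)
    ≡⟨ *-distribˡ-+ (suc (suc k)) c₁ c₂ ⟩
  c₁ + suc k * c₁ + suc (suc k) * c₂
    ≡⟨ cong₂ (λ u v → c₁ + u + v) ([k+1]*[n+1]C[k+1]≡[n+1]*nCk n k)
                                  ([k+1]*[n+1]C[k+1]≡[n+1]*nCk n (suc k)) ⟩
  c₁ + suc n * (n C k) + suc n * (n C suc k)
    ≡⟨ +-assoc c₁ (suc n * (n C k)) (suc n * (n C suc k)) ⟩
  c₁ + (suc n * (n C k) + suc n * (n C suc k))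
    ≡⟨ cong (c₁ +_) (*-distribˡ-+ (suc n) (n C k) (n C suc k)) ⟨
  c₁ + suc n * (n C k + n C suc k)
    ≡⟨ cong (λ c → c₁ + suc n * c) (nCk+nC[k+1]≡[n+1]C[k+1] n k) ⟩
  suc (suc n) * c₁ ∎
  where
  open ≡-Reasoning
  c₁ = suc n C suc k
  c₂ = suc n C suc (suc k)

prime∣pCk : ∀ {p k} → Prime p → 0 < k → k < p → p ∣ p C k
prime∣pCk {suc n} {suc k} pr _ k<p
  with euclidsLemma (suc k) (suc n C suc k) pr
         (divides (n C k) (trans ([k+1]*[n+1]C[k+1]≡[n+1]*nCk n k) (*-comm (suc n) (n C k))))
... | inj₁ p∣k = contradiction (∣⇒≤ p∣k) (<⇒≱ k<p)
... | inj₂ p∣C = p∣C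

×ᴬ≡* : ∀ m x → m ×ᴬ x ≡ m * x
×ᴬ≡* zero    x = refl
×ᴬ≡* (suc m) x = cong (x +_) (×ᴬ≡* m x)

^ᴬ≡^ : ∀ x n → x ^ᴬ n ≡ x ^ n
^ᴬ≡^ x zero    = refl
^ᴬ≡^ x (suc n) = cong (x *_) (^ᴬ≡^ x n)

∣-sum : ∀ {d n} (f : Vector ℕ n) → (∀ i → d ∣ f i) → d ∣ sum f
∣-sum {d} {zero}  f d∣f = d ∣0
∣-sum {d} {suc n} f d∣f = ∣m∣n⇒∣m+n (d∣f zero) (∣-sum (tail f) (λ i → d∣f (suc i)))

binomialTerm≡nCk*x^[n∸k] : ∀ n x (k : Fin (suc n)) →
  Binomial.binomialTerm 1 x n k ≡ (n C toℕ k) * x ^ (n ∸ toℕ k)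
binomialTerm≡nCk*x^[n∸k] n x k = begin
  (n C toℕ k) ×ᴬ (1 ^ᴬ toℕ k * x ^ᴬ (n ∸ toℕ k))
    ≡⟨ ×ᴬ≡* (n C toℕ k) _ ⟩
  (n C toℕ k) * (1 ^ᴬ toℕ k * x ^ᴬ (n ∸ toℕ k))
    ≡⟨ cong₂ (λ u v → (n C toℕ k) * (u * v))
             (trans (^ᴬ≡^ 1 (toℕ k)) (^-zeroˡ (toℕ k))) (^ᴬ≡^ x (n ∸ toℕ k)) ⟩
  (n C toℕ k) * (1 * x ^ (n ∸ toℕ k))
    ≡⟨ cong ((n C toℕ k) *_) (*-identityˡ (x ^ (n ∸ toℕ k))) ⟩
  (n C toℕ k) * x ^ (n ∸ toℕ k) ∎
  where open ≡-Reasoning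

-- All inner binomial coefficients of a prime exponent vanish modulo that prime.
[1+x]^p≡x^p+1 : ∀ {p} → Prime p → ∀ x → ∃[ t ] (1 + x) ^ p ≡ x ^ p + (t * p + 1)
[1+x]^p≡x^p+1 {p@(suc n)} pr x = t , (begin
  (1 + x) ^ p                             ≡⟨ ^ᴬ≡^ (1 + x) p ⟨
  (1 + x) ^ᴬ p                            ≡⟨ Binomial.theorem p 1 x ⟩
  sum f                                   ≡⟨ cong (head f +_) (sum-init-last (tail f)) ⟩
  head f + (sum (init (tail f)) + last f) ≡⟨ cong₂ (λ u v → u + (v + last f)) head≡ inner≡ ⟩
  x ^ p + (t * p + last f)                ≡⟨ cong (λ u → x ^ p + (t * p + u)) last≡ ⟩
  x ^ p + (t * p + 1)                     ∎)
  where
  open ≡-Reasoning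
  f = Binomial.binomialTerm 1 x p
  head≡ : head f ≡ x ^ p
  head≡ = trans (binomialTerm≡nCk*x^[n∸k] p x zero) (*-identityˡ (x ^ p))
  last≡ : last f ≡ 1
  last≡ = begin
    last f
      ≡⟨ binomialTerm≡nCk*x^[n∸k] p x (fromℕ p) ⟩
    (p C toℕ (fromℕ p)) * x ^ (p ∸ toℕ (fromℕ p))
      ≡⟨ cong (λ k → (p C k) * x ^ (p ∸ k)) (toℕ-fromℕ p) ⟩
    (p C p) * x ^ (p ∸ p)
      ≡⟨ cong₂ (λ c e → c * x ^ e) (nCn≡1 p) (n∸n≡0 p) ⟩
    1 ∎
  p∣inner : p ∣ sum (init (tail f))
  p∣inner = ∣-sum (init (tail f)) λ i →
    subst (p ∣_) (sym (binomialTerm≡nCk*x^[n∸k] p x (suc (inject₁ i))))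
      (∣m⇒∣m*n _ (prime∣pCk pr z<s (s<s (subst (_< n) (sym (toℕ-inject₁ i)) (toℕ<n i)))))
  t = _∣_.quotient p∣inner
  inner≡ : sum (init (tail f)) ≡ t * p
  inner≡ = _∣_.equality p∣inner

fermat : ∀ {p} → Prime p → ∀ a → ∃[ t ] a ^ p ≡ a + t * p
fermat {suc n} pr zero    = 0 , refl
fermat {p}     pr (suc a) with [1+x]^p≡x^p+1 pr a | fermat pr a
... | s , [1+a]^p≡ | t , a^p≡ = t + s , (begin
  (1 + a) ^ p             ≡⟨ [1+a]^p≡ ⟩
  a ^ p + (s * p + 1)     ≡⟨ cong (_+ (s * p + 1)) a^p≡ ⟩
  a + t * p + (s * p + 1) ≡⟨ regroup a t s p ⟩
  suc a + (t + s) * p     ∎)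
  where
  open ≡-Reasoning
  regroup : ∀ a t s p → a + t * p + (s * p + 1) ≡ suc a + (t + s) * p
  regroup = solve-∀

-- y ≡ 1 (mod q), for positive y, stated without truncated subtraction.
infix 4 _≡1mod_
_≡1mod_ : ℕ → ℕ → Set
y ≡1mod q = ∃[ t ] y ≡ 1 + t * q

≡1mod-* : ∀ {q x y} → x ≡1mod q → y ≡1mod q → x * y ≡1mod q
≡1mod-* {q} (t , refl) (s , refl) = t + s + t * s * q , expand t s q
  where
  expand : ∀ t s q → (1 + t * q) * (1 + s * q) ≡ 1 + (t + s + t * s * q) * q
  expand = solve-∀

≡1mod-^ : ∀ {q x} → x ≡1mod q → ∀ k → x ^ k ≡1mod q
≡1mod-^ x≡1 zero    = 0 , refl
≡1mod-^ x≡1 (suc k) = ≡1mod-* x≡1 (≡1mod-^ x≡1 k)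

≡1mod-cancelʳ : ∀ {q x y} → y ≡1mod q → x * y ≡1mod q → x ≡1mod q
≡1mod-cancelʳ {q} {zero}  _          (_ , ())
≡1mod-cancelʳ {q} {suc x} (s , refl) (u , xy≡) = _∣_.quotient q∣x , cong suc (_∣_.equality q∣x)
  where
  expand : ∀ x s q → suc x * (1 + s * q) ≡ suc (suc x * s * q + x)
  expand = solve-∀
  q∣x : q ∣ x
  q∣x = ∣m+n∣m⇒∣n (divides u (suc-injective (trans (sym (expand x s q)) xy≡))) (n∣m*n (suc x * s))

prime-cancelˡ-≡1mod : ∀ {q a y t} → Prime q → ¬ q ∣ a → a * y ≡ a + t * q → y ≡1mod q
prime-cancelˡ-≡1mod {q} {a} {zero} pr q∤a a*0≡ =
  contradiction (subst (q ∣_) (sym a≡0) (q ∣0)) q∤a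
  where
  a≡0 : a ≡ 0
  a≡0 = m+n≡0⇒m≡0 a (sym (trans (sym (*-zeroʳ a)) a*0≡))
prime-cancelˡ-≡1mod {q} {a} {suc y} {t} pr q∤a a*y≡
  with euclidsLemma a y pr (divides t (+-cancelˡ-≡ a _ _ (trans (sym (*-suc a y)) a*y≡)))
... | inj₁ q∣a           = contradiction q∣a q∤a
... | inj₂ (divides w y≡) = w , cong suc y≡

fermat-≡1mod : ∀ {q a} → Prime q → ¬ q ∣ a → a ^ (q ∸ 1) ≡1mod q
fermat-≡1mod {suc n} {a} pr q∤a with fermat pr a
... | t , a^q≡ = prime-cancelˡ-≡1mod {t = t} pr q∤a a^q≡

^≡1mod-combine : ∀ {q} a m n d x y → a ^ m ≡1mod q → a ^ n ≡1mod q → d + y * n ≡ x * m →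
  a ^ d ≡1mod q
^≡1mod-combine {q} a m n d x y a^m≡1 a^n≡1 eq =
  ≡1mod-cancelʳ a^yn≡1 (subst (_≡1mod q) a^xm≡a^d*a^yn (≡1mod-^ a^m≡1 x))
  where
  a^yn≡1 : a ^ (y * n) ≡1mod q
  a^yn≡1 = subst (_≡1mod q) (trans (^-*-assoc a n y) (cong (a ^_) (*-comm n y)))
                 (≡1mod-^ a^n≡1 y)
  a^xm≡a^d*a^yn : (a ^ m) ^ x ≡ a ^ d * a ^ (y * n)
  a^xm≡a^d*a^yn = begin
    (a ^ m) ^ x         ≡⟨ ^-*-assoc a m x ⟩
    a ^ (m * x)         ≡⟨ cong (a ^_) (trans (*-comm m x) (sym eq)) ⟩
    a ^ (d + y * n)     ≡⟨ ^-distribˡ-+-* a d (y * n) ⟩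
    a ^ d * a ^ (y * n) ∎
    where open ≡-Reasoning

^≡1mod-Bézout : ∀ {q} a {d m n} → a ^ m ≡1mod q → a ^ n ≡1mod q → Bézout.Identity d m n →
  a ^ d ≡1mod q
^≡1mod-Bézout a {d} {m} {n} a^m≡1 a^n≡1 (+- x y eq) = ^≡1mod-combine a m n d x y a^m≡1 a^n≡1 eq
^≡1mod-Bézout a {d} {m} {n} a^m≡1 a^n≡1 (-+ x y eq) = ^≡1mod-combine a n m d y x a^n≡1 a^m≡1 eq

∣∧≡1mod⇒≡1 : ∀ {q y} → q ∣ y → y ≡1mod q → q ≡ 1
∣∧≡1mod⇒≡1 {q} q∣y (t , refl) =
  ∣1⇒≡1 (∣m+n∣m⇒∣n (subst (q ∣_) (+-comm 1 (t * q)) q∣y) (n∣m*n t))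

≡1mod⇒∣∸1 : ∀ {q y} → y ≡1mod q → q ∣ y ∸ 1
≡1mod⇒∣∸1 (t , refl) = divides t refl

≡1mod⇒∣∸ : ∀ {p x y} → x ≡1mod p → y ≡1mod p → p ∣ y ∸ x
≡1mod⇒∣∸ {p} (t , refl) (s , refl) = divides (s ∸ t) (sym (*-distribʳ-∸ p s t))

prime∤⇒coprime : ∀ {p n} → Prime p → ¬ p ∣ n → Coprime p n
prime∤⇒coprime pr p∤n (d∣p , d∣n) with prime⇒irreducible pr d∣p
... | inj₁ d≡1 = d≡1
... | inj₂ refl = contradiction d∣n p∤n

-- The hypotheses on a say that a has order p modulo q.
prime-order∣q∸1 : ∀ {p q a} → Prime p → Prime q → a ^ p ≡1mod q → ¬ a ≡1mod q → p ∣ q ∸ 1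
prime-order∣q∸1 {p@(suc p′)} {q@(suc n)} {a} pp pq a^p≡1 a≢1 with p ∣? n
... | yes p∣n = p∣n
... | no  p∤n = contradiction a≡1 a≢1
  where
  q∤a : ¬ q ∣ a
  q∤a q∣a = ¬prime[1] (subst Prime (∣∧≡1mod⇒≡1 (∣m⇒∣m*n (a ^ p′) q∣a) a^p≡1) pq)
  a≡1 : a ≡1mod q
  a≡1 = subst (_≡1mod q) (^-identityʳ a)
    (^≡1mod-Bézout a a^p≡1 (fermat-≡1mod pq q∤a) (coprime-Bézout (prime∤⇒coprime pp p∤n)))

a^p≡1+M*[a∸1] : ∀ {a} p → 1 < a → a ^ p ≡ 1 + M a p * (a ∸ 1)
a^p≡1+M*[a∸1] {suc (suc b)} p _ with ≡1mod-^ a≡1 p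
  where
  a≡1 : suc (suc b) ≡1mod suc b
  a≡1 = 1 , cong suc (sym (*-identityˡ (suc b)))
... | t , a^p≡ = trans a^p≡ (cong (λ m → 1 + m * suc b) (sym M≡t))
  where
  M≡t : M (suc (suc b)) p ≡ t
  M≡t = trans (cong (λ z → (z ∸ 1) / suc b) a^p≡) (m*n/n≡m t (suc b))
a^p≡1+M*[a∸1] {suc zero} p (s≤s ())

M≢0 : ∀ {a p} → 1 < a → 0 < p → M a p ≢ 0
M≢0 {a} {suc p} 1<a _ M≡0 = <⇒≢ 1<a (sym (∣1⇒≡1 (subst (a ∣_) a^p≡1 (m∣m*n (a ^ p)))))
  where
  a^p≡1 : a ^ suc p ≡ 1
  a^p≡1 = trans (a^p≡1+M*[a∸1] (suc p) 1<a) (cong (λ m → 1 + m * (a ∸ 1)) M≡0)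

prime∣M⇒≡1mod : ∀ {a p q} → 1 < a → Prime p → gcd (M a p) (a ∸ 1) ≡ 1 →
  Prime q → q ∣ M a p → q ≡1mod p
prime∣M⇒≡1mod {a} {p} {q@(suc n)} 1<a pp gcd≡1 pq q∣M@(divides w M≡w*q)
  with prime-order∣q∸1 pp pq a^p≡1 a≢1
  where
  a^p≡1 : a ^ p ≡1mod q
  a^p≡1 = w * (a ∸ 1) , (begin
    a ^ p               ≡⟨ a^p≡1+M*[a∸1] p 1<a ⟩
    1 + M a p * (a ∸ 1) ≡⟨ cong (λ m → 1 + m * (a ∸ 1)) M≡w*q ⟩
    1 + w * q * (a ∸ 1) ≡⟨ cong (1 +_) (xy∙z≈xz∙y w q (a ∸ 1)) ⟩
    1 + w * (a ∸ 1) * q ∎)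
    where open ≡-Reasoning
  a≢1 : ¬ a ≡1mod q
  a≢1 a≡1 = ¬prime[1] (subst Prime (∣1⇒≡1 q∣1) pq)
    where
    q∣1 : q ∣ 1
    q∣1 = subst (q ∣_) gcd≡1 (gcd-greatest q∣M (≡1mod⇒∣∸1 a≡1))
... | divides s n≡s*p = s , cong suc n≡s*p

∣⇒≡1mod : ∀ {n p d} → n ≢ 0 → (∀ {q} → Prime q → q ∣ n → q ≡1mod p) → d ∣ n → d ≡1mod p
∣⇒≡1mod {n} {p} {d} n≢0 primes≡1 d∣n = subst (_≡1mod p) (sym isFactorisation)
  (product≡1mod factors factorsPrime (subst (_∣ n) isFactorisation d∣n))
  where
  d≢0 : d ≢ 0
  d≢0 refl = n≢0 (0∣⇒≡0 d∣n)
  open PrimeFactorisation (factorise d {{≢-nonZero d≢0}})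
  product≡1mod : ∀ qs → All Prime qs → product qs ∣ n → product qs ≡1mod p
  product≡1mod []       []          _   = 0 , refl
  product≡1mod (q ∷ qs) (pq ∷ pqs) ∏∣n =
    ≡1mod-* (primes≡1 pq (∣-trans (m∣m*n (product qs)) ∏∣n))
            (product≡1mod qs pqs (∣-trans (n∣m*n q) ∏∣n))

corollary4 : (a p : ℕ) → 1 < a → Prime p → gcd (M a p) (a ∸ 1) ≡ 1 →
    (d₁ d₂ : ℕ) → d₁ ∣ M a p → d₂ ∣ M a p → d₁ < d₂ → p ∣ (d₂ ∸ d₁)
corollary4 a p 1<a pp gcd≡1 d₁ d₂ d₁∣M d₂∣M _ =
  ≡1mod⇒∣∸ (divisor≡1 d₁∣M) (divisor≡1 d₂∣M)
  where
  M≢0′ : M a p ≢ 0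
  M≢0′ = M≢0 1<a (>-nonZero⁻¹ p {{prime⇒nonZero pp}})
  divisor≡1 : ∀ {d} → d ∣ M a p → d ≡1mod p
  divisor≡1 = ∣⇒≡1mod M≢0′ (prime∣M⇒≡1mod 1<a pp gcd≡1)
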